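{- Let $\lambda=(\lambda_1,\ldots,\lambda_t)$ be an unrefinable partition into distinct parts with $\#\mathcal{M}_\lambda=\lfloor\lambda_t/2\rfloor$, such that $\lambda_t$ is an odd integer coprime with $3$. Then the set $S_\lambda=\mathbb{N}_0\setminus\{\lambda_1,\ldots,\lambda_t\}$ is a numerical semigroup.
   Context: A partition into distinct parts is a sequence $\lambda=(\lambda_1,\ldots,\lambda_t)$ of positive integers with $\lambda_1<\cdots<\lambda_t$ and $t\ge 2$. Its set of missing parts is $\mathcal{M}_\lambda=\{1,\ldots,\lambda_t\}\setminus\{\lambda_1,\ldots,\lambda_t\}$. $\lambda$ is refinable if some part equals a sum of at least two pairwise distinct missing parts, and unrefinable otherwise. A numerical semigroup is a subset of $\mathbb{N}_0$ containing $0$, closed under addition, with finite complement in $\mathbb{N}_0$. -}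

module Defs where

open import Data.Nat using (ℕ; zero; suc; _+_; _*_; _≤_; _<_; _≥_; _/_; _≟_)
open import Data.List using (List; []; _∷_; length; filter; upTo; map)
open import Data.Nat.ListAction using (sum)
open import Relation.Binary.PropositionalEquality using (_≡_)
open import Data.List.Membership.Propositional using (_∈_; _∉_)
open import Data.List.Membership.DecPropositional _≟_ using (_∈?_)
open import Data.List.Relation.Unary.All using (All)
open import Data.List.Relation.Unary.Linked using (Linked)
open import Data.List.Relation.Unary.Unique.Propositional using (Unique)
open import Data.Maybe using (Maybe; just; nothing)
open import Data.Product using (Σ; _×_; ∃; _,_)
open import Relation.Nullary using (¬_)
open import Relation.Nullary.Decidable using (¬?)

record DistinctPartition : Set where
  constructor mkDP
  field
    parts      : List ℕ
    increasing : Linked _<_ parts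
    positive   : All (λ x → 1 ≤ x) parts
    atLeastTwo : 2 ≤ length parts

open DistinctPartition public

-- the largest part λₜ (the last element; 0 only for the empty list, which is excluded)
largest : List ℕ → ℕ
largest [] = 0
largest (x ∷ []) = x
largest (x ∷ y ∷ ys) = largest (y ∷ ys)

oneTo : ℕ → List ℕ
oneTo n = map suc (upTo n)

missingParts : List ℕ → List ℕ
missingParts ps = filter (λ n → ¬? (n ∈? ps)) (oneTo (largest ps))

IsMissing : List ℕ → ℕ → Set
IsMissing ps m = 1 ≤ m × m ≤ largest ps × m ∉ ps

Refinable : DistinctPartition → Set
Refinable l =
  Σ ℕ λ p → p ∈ parts l ×
  Σ (List ℕ) λ ms → 2 ≤ length ms × Unique ms ×
     All (IsMissing (parts l)) ms × sum ms ≡ p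

Unrefinable : DistinctPartition → Set
Unrefinable l = ¬ Refinable l

record NumericalSemigroup (S : ℕ → Set) : Set where
  field
    hasZero      : S 0
    closed       : ∀ a b → S a → S b → S (a + b)
    cofinite     : ∃ λ N → ∀ n → N ≤ n → S n

Sλ : DistinctPartition → ℕ → Set
Sλ l n = n ∉ parts l

module Submission where

-- Write L = λₜ = 2K + 1. Since L is a part, the K missing parts lie in 1, …, 2K,
-- which splits into the K pairs {a, L − a}. A pair of missing parts (distinct, as
-- L is odd) summing to the part L would refine λ, so every pair contains at most
-- one missing part, hence exactly one. Now let a, b be missing with a + b a part.
-- If a ≠ b, λ is refinable. If a = b, put c = L − 2a: as 2a is a part, c is
-- missing; as a is missing, a + c = L − a is a part; and c ≠ a because 3 ∤ L, so
-- c + a again refines λ.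

open import Defs
open import Data.Nat using (ℕ; zero; suc; _+_; _*_; _∸_; _/_; _%_; _≤_; _<_; z≤n; s≤s; _≟_)
open import Data.Nat.Coprimality using (Coprime)
open import Data.List using ([]; _∷_; length; filter; applyUpTo)
open import Data.List.Membership.Propositional using (_∈_; _∉_)
open import Data.List.Properties using (map-upTo)
open import Data.List.Relation.Unary.All using ([]; _∷_)
import Data.List.Relation.Unary.All as All
open import Data.List.Relation.Unary.AllPairs using ([]; _∷_)
open import Data.List.Relation.Unary.Any using (here; there)
open import Data.List.Relation.Unary.Linked using (Linked; [-]; _∷_)
open import Data.Nat.DivMod using (m≡m%n+[m/n]*n)
open import Data.Nat.Divisibility using (divides)
open import Data.List.Membership.DecPropositional _≟_ using (_∈?_)
open import Data.Nat.Properties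
open import Algebra.Properties.CommutativeSemigroup +-commutativeSemigroup using (interchange)
open import Data.Product using (_×_; _,_)
open import Data.Sum using (_⊎_; inj₁; inj₂)
open import Function using (_∘_)
open import Level using (Level)
open import Relation.Binary.PropositionalEquality
  using (_≡_; _≢_; refl; sym; trans; cong; cong₂; subst; module ≡-Reasoning)
open import Relation.Nullary using (¬_; Dec; yes; no; contradiction)
open import Relation.Nullary.Decidable using (¬?)
open import Relation.Unary using (Pred; Decidable)

open ≡-Reasoning

private
  variable
    a b : Level
    A : Set a
    B : Set b

sumBelow : (ℕ → ℕ) → ℕ → ℕ
sumBelow f zero    = 0
sumBelow f (suc n) = sumBelow f n + f n

sumBelow-unfoldˡ : ∀ f n → sumBelow f (suc n) ≡ f 0 + sumBelow (f ∘ suc) n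
sumBelow-unfoldˡ f zero    = +-comm 0 (f 0)
sumBelow-unfoldˡ f (suc n) = begin
  sumBelow f (suc n) + f (suc n)          ≡⟨ cong (_+ f (suc n)) (sumBelow-unfoldˡ f n) ⟩
  f 0 + sumBelow (f ∘ suc) n + f (suc n)  ≡⟨ +-assoc (f 0) _ _ ⟩
  f 0 + sumBelow (f ∘ suc) (suc n)        ∎

sumBelow-reverse : ∀ f n → sumBelow f n ≡ sumBelow (λ x → f (n ∸ suc x)) n
sumBelow-reverse f zero    = refl
sumBelow-reverse f (suc n) = begin
  sumBelow f n + f n                          ≡⟨ cong (_+ f n) (sumBelow-reverse f n) ⟩
  sumBelow (λ x → f (n ∸ suc x)) n + f n      ≡⟨ +-comm _ (f n) ⟩
  f n + sumBelow (λ x → f (n ∸ suc x)) n      ≡⟨ sumBelow-unfoldˡ (λ x → f (suc n ∸ suc x)) n ⟨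
  sumBelow (λ x → f (suc n ∸ suc x)) (suc n)  ∎

sumBelow-distrib-+ : ∀ f g n → sumBelow (λ x → f x + g x) n ≡ sumBelow f n + sumBelow g n
sumBelow-distrib-+ f g zero    = refl
sumBelow-distrib-+ f g (suc n) =
  trans (cong (_+ (f n + g n)) (sumBelow-distrib-+ f g n))
        (interchange (sumBelow f n) (sumBelow g n) (f n) (g n))

+-≡suc⇒tight : ∀ {m k} n → m ≤ k → n ≤ 1 → m + n ≡ suc k → m ≡ k × n ≡ 1
+-≡suc⇒tight {m} 0 m≤k _ m+0≡1+k =
  contradiction (subst (_≤ _) (trans (sym (+-identityʳ m)) m+0≡1+k) m≤k) 1+n≰n
+-≡suc⇒tight {m} 1 _ _ m+1≡1+k = suc-injective (trans (+-comm 1 m) m+1≡1+k) , refl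
+-≡suc⇒tight (suc (suc _)) _ (s≤s ()) _

sumBelow-≤ : ∀ f n → (∀ x → x < n → f x ≤ 1) → sumBelow f n ≤ n
sumBelow-≤ f zero    _   = z≤n
sumBelow-≤ f (suc n) f≤1 = subst (sumBelow f n + f n ≤_) (+-comm n 1)
  (+-mono-≤ (sumBelow-≤ f n (λ x x<n → f≤1 x (m<n⇒m<1+n x<n))) (f≤1 n ≤-refl))

sumBelow≡n⇒≡1 : ∀ f n → (∀ x → x < n → f x ≤ 1) → sumBelow f n ≡ n →
                ∀ x → x < n → f x ≡ 1
sumBelow≡n⇒≡1 f (suc n) f≤1 sum≡ x x<1+n
  with +-≡suc⇒tight (f n) (sumBelow-≤ f n (λ y y<n → f≤1 y (m<n⇒m<1+n y<n))) (f≤1 n ≤-refl) sum≡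
     | m<1+n⇒m<n∨m≡n x<1+n
... | sum≡n , _    | inj₁ x<n  =
  sumBelow≡n⇒≡1 f n (λ y y<n → f≤1 y (m<n⇒m<1+n y<n)) sum≡n x x<n
... | _     , fn≡1 | inj₂ refl = fn≡1

sumBelow-complementary : ∀ g n →
  (∀ x y → suc (x + y) ≡ n → g x + g y ≤ 1) →
  sumBelow g n + sumBelow g n ≡ n →
  ∀ x y → suc (x + y) ≡ n → g x + g y ≡ 1
sumBelow-complementary g n pair≤1 total x y 1+x+y≡n =
  subst (λ z → g x + g z ≡ 1) n∸1+x≡y (pair≡1 x x<n)
  where
  pair : ℕ → ℕ
  pair x = g x + g (n ∸ suc x)

  sum-pair≡n : sumBelow pair n ≡ n
  sum-pair≡n = begin
    sumBelow pair n                                  ≡⟨ sumBelow-distrib-+ g _ n ⟩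
    sumBelow g n + sumBelow (λ x → g (n ∸ suc x)) n  ≡⟨ cong (sumBelow g n +_) (sumBelow-reverse g n) ⟨
    sumBelow g n + sumBelow g n                      ≡⟨ total ⟩
    n                                                ∎

  pair≡1 : ∀ x → x < n → pair x ≡ 1
  pair≡1 = sumBelow≡n⇒≡1 pair n (λ x x<n → pair≤1 x _ (m+[n∸m]≡n x<n)) sum-pair≡n

  x<n : x < n
  x<n = subst (suc x ≤_) 1+x+y≡n (s≤s (m≤m+n x y))

  n∸1+x≡y : n ∸ suc x ≡ y
  n∸1+x≡y = trans (cong (_∸ suc x) (sym 1+x+y≡n)) (m+n∸m≡n (suc x) y)

indicator : Dec A → ℕ
indicator (yes _) = 1
indicator (no _)  = 0

indicator-no : (a? : Dec A) → ¬ A → indicator a? ≡ 0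
indicator-no (yes a) ¬a = contradiction a ¬a
indicator-no (no _)  _  = refl

indicator-+-≤1 : (a? : Dec A) (b? : Dec B) → ¬ (A × B) → indicator a? + indicator b? ≤ 1
indicator-+-≤1 (yes a) (yes b) ¬ab = contradiction (a , b) ¬ab
indicator-+-≤1 (yes _) (no _)  _   = ≤-refl
indicator-+-≤1 (no _)  (yes _) _   = ≤-refl
indicator-+-≤1 (no _)  (no _)  _   = z≤n

indicator-+-≡1 : (a? : Dec A) (b? : Dec B) → indicator a? + indicator b? ≡ 1 → A ⊎ B
indicator-+-≡1 (yes a) _       _ = inj₁ a
indicator-+-≡1 (no _)  (yes b) _ = inj₂ b

module _ {P : Pred ℕ a} (P? : Decidable P) where

  length-filter-∷ : ∀ x xs →
    length (filter P? (x ∷ xs)) ≡ indicator (P? x) + length (filter P? xs)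
  length-filter-∷ x xs with P? x
  ... | yes _ = refl
  ... | no _  = refl

  length-filter-applyUpTo : ∀ f n →
    length (filter P? (applyUpTo f n)) ≡ sumBelow (λ i → indicator (P? (f i))) n
  length-filter-applyUpTo f zero    = refl
  length-filter-applyUpTo f (suc n) = begin
    length (filter P? (applyUpTo f (suc n)))
      ≡⟨ length-filter-∷ (f 0) _ ⟩
    indicator (P? (f 0)) + length (filter P? (applyUpTo (f ∘ suc) n))
      ≡⟨ cong (indicator (P? (f 0)) +_) (length-filter-applyUpTo (f ∘ suc) n) ⟩
    indicator (P? (f 0)) + sumBelow (λ i → indicator (P? (f (suc i)))) n
      ≡⟨ sumBelow-unfoldˡ (λ i → indicator (P? (f i))) n ⟨
    sumBelow (λ i → indicator (P? (f i))) (suc n)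
      ∎

suc[m+m]≢n+n : ∀ m n → suc (m + m) ≢ n + n
suc[m+m]≢n+n m       zero    ()
suc[m+m]≢n+n zero    (suc n) eq = contradiction (trans (suc-injective eq) (+-suc n n)) λ ()
suc[m+m]≢n+n (suc m) (suc n) eq rewrite +-suc m m | +-suc n n =
  suc[m+m]≢n+n m n (suc-injective (suc-injective eq))

odd⇒≡1+2*half : ∀ n → n % 2 ≡ 1 → n ≡ suc (n / 2 + n / 2)
odd⇒≡1+2*half n odd = begin
  n                      ≡⟨ m≡m%n+[m/n]*n n 2 ⟩
  n % 2 + n / 2 * 2      ≡⟨ cong (_+ n / 2 * 2) odd ⟩
  suc (n / 2 * 2)        ≡⟨ cong suc (*-comm (n / 2) 2) ⟩
  suc (2 * (n / 2))      ≡⟨ cong (λ z → suc (n / 2 + z)) (+-identityʳ (n / 2)) ⟩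
  suc (n / 2 + n / 2)    ∎

largest-∈ : ∀ x xs → largest (x ∷ xs) ∈ x ∷ xs
largest-∈ x []       = here refl
largest-∈ x (y ∷ ys) = there (largest-∈ y ys)

∈⇒≤largest : ∀ {xs} → Linked _<_ xs → ∀ {p} → p ∈ xs → p ≤ largest xs
∈⇒≤largest [-]          (here refl) = ≤-refl
∈⇒≤largest (x<y ∷ x∷xs) (here refl) = ≤-trans (<⇒≤ x<y) (∈⇒≤largest x∷xs (here refl))
∈⇒≤largest (_ ∷ x∷xs)   (there p∈)  = ∈⇒≤largest x∷xs p∈

module _ (l : DistinctPartition) where

  private
    ps = parts l
    L  = largest ps

  largest∈parts : L ∈ ps
  largest∈parts with ps | atLeastTwo l
  ... | x ∷ xs | _ = largest-∈ x xs

  ∈parts⇒≤largest : ∀ {p} → p ∈ ps → p ≤ L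
  ∈parts⇒≤largest = ∈⇒≤largest (increasing l)

  0∉parts : 0 ∉ ps
  0∉parts 0∈ with All.lookup (positive l) 0∈
  ... | ()

  ∉parts⇒IsMissing : ∀ {m p} → 1 ≤ m → m ≤ p → p ∈ ps → m ∉ ps → IsMissing ps m
  ∉parts⇒IsMissing 1≤m m≤p p∈ m∉ = 1≤m , ≤-trans m≤p (∈parts⇒≤largest p∈) , m∉

  Unrefinable⇒+∉parts : Unrefinable l → ∀ {m n} → m ≢ n →
    IsMissing ps m → IsMissing ps n → m + n ∉ ps
  Unrefinable⇒+∉parts unref {m} {n} m≢n m-missing n-missing m+n∈ =
    unref (m + n , m+n∈ , m ∷ n ∷ [] , s≤s (s≤s z≤n) , (m≢n ∷ []) ∷ [] ∷ [] ,
           m-missing ∷ n-missing ∷ [] , cong (m +_) (+-identityʳ n))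

module _ (l : DistinctPartition) (unref : Unrefinable l) {K : ℕ}
         (L≡1+2K : largest (parts l) ≡ suc (K + K)) where

  private
    ps = parts l
    L  = largest ps

  complements-not-both-missing : ∀ {m n} → 1 ≤ m → 1 ≤ n → m + n ≡ L → ¬ (m ∉ ps × n ∉ ps)
  complements-not-both-missing {m} {n} 1≤m 1≤n m+n≡L (m∉ , n∉) =
    Unrefinable⇒+∉parts l unref m≢n
      (∉parts⇒IsMissing l 1≤m (m≤m+n m n) m+n∈ m∉)
      (∉parts⇒IsMissing l 1≤n (m≤n+m n m) m+n∈ n∉)
      m+n∈
    where
    m+n∈ : m + n ∈ ps
    m+n∈ = subst (_∈ ps) (sym m+n≡L) (largest∈parts l)

    m≢n : m ≢ n
    m≢n refl = suc[m+m]≢n+n K m (sym (trans m+n≡L L≡1+2K))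

  module _ (count : length (missingParts ps) ≡ K) where

    private
      missing? : Decidable (_∉ ps)
      missing? m = ¬? (m ∈? ps)

      g : ℕ → ℕ
      g i = indicator (missing? (suc i))

      sum-g≡K : sumBelow g (K + K) ≡ K
      sum-g≡K = begin
        sumBelow g (K + K)                          ≡⟨ +-identityʳ _ ⟨
        sumBelow g (K + K) + 0                      ≡⟨ cong (sumBelow g (K + K) +_) L-not-missing ⟨
        sumBelow g (suc (K + K))                    ≡⟨ cong (sumBelow g) L≡1+2K ⟨
        sumBelow g L                                ≡⟨ length-filter-applyUpTo missing? suc L ⟨
        length (filter missing? (applyUpTo suc L))  ≡⟨ cong (length ∘ filter missing?) (map-upTo suc L) ⟨
        length (missingParts ps)                    ≡⟨ count ⟩
        K                                           ∎
        where
        L-not-missing : g (K + K) ≡ 0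
        L-not-missing = indicator-no (missing? (suc (K + K)))
          (λ L∉ → L∉ (subst (_∈ ps) L≡1+2K (largest∈parts l)))

      1+x+1+y≡L⇒1+x+y≡2K : ∀ {x y} → suc x + suc y ≡ L → suc (x + y) ≡ K + K
      1+x+1+y≡L⇒1+x+y≡2K {x} {y} eq =
        suc-injective (trans (sym (cong suc (+-suc x y))) (trans eq L≡1+2K))

      1+x+y≡2K⇒1+x+1+y≡L : ∀ {x y} → suc (x + y) ≡ K + K → suc x + suc y ≡ L
      1+x+y≡2K⇒1+x+1+y≡L {x} {y} eq =
        trans (cong suc (+-suc x y)) (trans (cong suc eq) (sym L≡1+2K))

    complements-some-missing : ∀ {m n} → 1 ≤ m → 1 ≤ n → m + n ≡ L → m ∉ ps ⊎ n ∉ ps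
    complements-some-missing {suc x} {suc y} _ _ eq =
      indicator-+-≡1 (missing? (suc x)) (missing? (suc y))
        (sumBelow-complementary g (K + K) pair≤1 (cong₂ _+_ sum-g≡K sum-g≡K)
          x y (1+x+1+y≡L⇒1+x+y≡2K eq))
      where
      pair≤1 : ∀ x y → suc (x + y) ≡ K + K → g x + g y ≤ 1
      pair≤1 x y eq = indicator-+-≤1 (missing? (suc x)) (missing? (suc y))
        (complements-not-both-missing (s≤s z≤n) (s≤s z≤n) (1+x+y≡2K⇒1+x+1+y≡L eq))

    module _ (coprime : Coprime L 3) where

      L≢3m : ∀ m → L ≢ m + m + m
      L≢3m m L≡3m = contradiction (coprime (divides m L≡m*3 , divides 1 refl)) λ ()
        where
        L≡m*3 : L ≡ m * 3
        L≡m*3 = begin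
          L                  ≡⟨ L≡3m ⟩
          m + m + m          ≡⟨ +-assoc m m m ⟩
          m + (m + m)        ≡⟨ cong (λ z → m + (m + z)) (+-identityʳ m) ⟨
          3 * m              ≡⟨ *-comm 3 m ⟩
          m * 3              ∎

      double-missing : ∀ {m} → 1 ≤ m → m ∉ ps → m + m ∉ ps
      double-missing {m} 1≤m m∉ 2m∈ =
        Unrefinable⇒+∉parts l unref c≢m
          (∉parts⇒IsMissing l 1≤c (m≤m+n c m) c+m∈ c∉)
          (∉parts⇒IsMissing l 1≤m (m≤n+m m c) c+m∈ m∉)
          c+m∈
        where
        2m<L : m + m < L
        2m<L with m≤n⇒m<n∨m≡n (∈parts⇒≤largest l 2m∈)
        ... | inj₁ 2m<L = 2m<L
        ... | inj₂ 2m≡L = contradiction (sym (trans 2m≡L L≡1+2K)) (suc[m+m]≢n+n K m)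

        c : ℕ
        c = L ∸ (m + m)

        1≤c : 1 ≤ c
        1≤c = m<n⇒0<n∸m 2m<L

        2m+c≡L : m + m + c ≡ L
        2m+c≡L = m+[n∸m]≡n (<⇒≤ 2m<L)

        c∉ : c ∉ ps
        c∉ with complements-some-missing (≤-trans 1≤m (m≤m+n m m)) 1≤c 2m+c≡L
        ... | inj₁ 2m∉ = contradiction 2m∈ 2m∉
        ... | inj₂ c∉  = c∉

        m+c∈ : m + c ∈ ps
        m+c∈ with (m + c) ∈? ps
        ... | yes m+c∈ = m+c∈
        ... | no m+c∉  = contradiction (m∉ , m+c∉)
          (complements-not-both-missing 1≤m (≤-trans 1≤c (m≤n+m c m))
            (trans (sym (+-assoc m m c)) 2m+c≡L))

        c+m∈ : c + m ∈ ps
        c+m∈ = subst (_∈ ps) (+-comm m c) m+c∈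

        c≢m : c ≢ m
        c≢m c≡m = L≢3m m (trans (sym 2m+c≡L) (cong (m + m +_) c≡m))

      missing-+-closed : ∀ m n → m ∉ ps → n ∉ ps → m + n ∉ ps
      missing-+-closed zero    n       _  n∉ = n∉
      missing-+-closed (suc m) zero    m∉ _  = subst (_∉ ps) (sym (+-identityʳ (suc m))) m∉
      missing-+-closed (suc m) (suc n) m∉ n∉ m+n∈ with suc m ≟ suc n
      ... | yes refl = double-missing (s≤s z≤n) m∉ m+n∈
      ... | no m≢n   = Unrefinable⇒+∉parts l unref m≢n
        (∉parts⇒IsMissing l (s≤s z≤n) (m≤m+n (suc m) (suc n)) m+n∈ m∉)
        (∉parts⇒IsMissing l (s≤s z≤n) (m≤n+m (suc n) (suc m)) m+n∈ n∉)
        m+n∈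

mainTheorem6 : (l : DistinctPartition) → Unrefinable l →
    length (missingParts (parts l)) ≡ largest (parts l) / 2 →
    largest (parts l) % 2 ≡ 1 → Coprime (largest (parts l)) 3 →
    NumericalSemigroup (Sλ l)
mainTheorem6 l unref count odd coprime = record
  { hasZero  = 0∉parts l
  ; closed   = missing-+-closed l unref (odd⇒≡1+2*half (largest (parts l)) odd) count coprime
  ; cofinite = suc (largest (parts l)) , λ n L<n n∈ → ≤⇒≯ (∈parts⇒≤largest l n∈) L<n
  }
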